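{- Let $k$ and $n\ge 5$ be odd integers. Then in the graph $\mathrm{CP}(k,n)$, at least one of the vertices $k$ or $k+n-1$ has at least two neighbors of opposite parity to itself.
   Context: For an integer $k$ and a positive integer $n$, $\mathrm{CP}(k,n)$ is the simple graph with vertex set $\{k,k+1,\ldots,k+n-1\}$ in which two distinct vertices $a,b$ are adjacent if and only if $\gcd(a,b)=1$ (with $\gcd(a,0)=|a|$). -}

module Defs where

open import Data.Nat using (ℕ; _<_)
open import Data.Integer using (ℤ; +_; _+_; _-_; 1ℤ)
open import Data.Integer.GCD using (gcd)
open import Data.Integer.Divisibility using (_∣_)
open import Data.Product using (Σ; _×_)
open import Relation.Binary.PropositionalEquality using (_≡_; _≢_)
open import Relation.Nullary using (¬_)

Odd : ℤ → Set
Odd x = ¬ ((+ 2) ∣ x)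

InCP : ℤ → ℕ → ℤ → Set
InCP k n v = Σ ℕ (λ i → (i < n) × (v ≡ k + + i))

Adj : ℤ → ℕ → ℤ → ℤ → Set
Adj k n a b = InCP k n a × InCP k n b × (a ≢ b) × (gcd a b ≡ 1ℤ)

OppNbr : ℤ → ℕ → ℤ → ℤ → Set
OppNbr k n v u = Adj k n v u × Odd (u - v)

TwoOppNbrs : ℤ → ℕ → ℤ → Set
TwoOppNbrs k n v =
  Σ ℤ (λ u₁ → Σ ℤ (λ u₂ → (u₁ ≢ u₂) × OppNbr k n v u₁ × OppNbr k n v u₂))

module Submission where

-- Write n = r + 2; since n ≥ 5 is odd, r ≥ 3 is odd, so
-- r has a prime divisor p, which is odd and satisfies p ≤ r < n.  The two
-- end vertices k and k + n - 1 differ by n - 1 = r + 1, which is coprime to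
-- r, so p cannot divide both of them.
--   * If p ∤ k, then k + 1 and k + p are neighbours of k: their offsets 1 and
--     p are odd (opposite parity) and gcd(k, k + c) = gcd(k, c) = 1.
--   * If p ∤ k + n - 1, the same holds for the offsets -1 and -p from the
--     last vertex.

open import Defs
open import Data.Nat using (ℕ; _≤_)
open import Data.Integer using (ℤ; +_; _+_; _-_; 1ℤ)
open import Data.Sum using (_⊎_)

open import Data.Sum using (inj₁; inj₂)
open import Data.Nat as ℕ using (zero; suc; _<_; s≤s; z≤n; _∸_)
import Data.Nat.Properties as ℕP
open import Data.Nat.Divisibility as ℕD using (∣-refl; ∣-trans; ∣1⇒≡1)
open import Data.Nat.Primality using (Prime; prime⇒irreducible; prime⇒nonTrivial; ¬prime[1])
open import Data.Nat.Primality.Factorisation using (factorise)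
open import Data.List using (_∷_)
open import Data.Nat.ListAction using (product)
open import Data.List.Relation.Unary.All using (_∷_)
open import Data.Integer using (-_; 0ℤ; -1ℤ; ∣_∣)
import Data.Integer.Properties as ℤP
open import Data.Integer.GCD using (gcd)
open import Data.Integer.Divisibility.Signed using (∣ᵤ⇒∣; ∣⇒∣ᵤ; ∣m+n∣m⇒∣n; ∣m∣n⇒∣m-n)
  renaming (_∣_ to _∣ₛ_)
open import Data.Integer.Coprimality using (Coprime)
open import Data.Nat.Coprimality using (coprime⇒gcd≡1)
open import Data.Integer.Tactic.RingSolver using (solve-∀)
open import Algebra.Bundles using (AbelianGroup)
open import Algebra.Properties.Group (AbelianGroup.group ℤP.+-0-abelianGroup) using (∙-cancelˡ)
open import Data.Product using (Σ; _×_; _,_)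
open import Data.Empty using (⊥-elim)
open import Relation.Nullary using (¬_; yes; no)
open import Relation.Binary.PropositionalEquality

+-sub-cancelˡ : ∀ v c → (v + c) - v ≡ c
+-sub-cancelˡ = solve-∀

last-minus : ∀ k x y → ((k + (1ℤ + (x + y))) - 1ℤ) - y ≡ k + x
last-minus = solve-∀

last-minus-first : ∀ k x → ((k + (1ℤ + x)) - 1ℤ) - k ≡ x
last-minus-first = solve-∀

last≡ : ∀ k x → (k + (1ℤ + x)) - 1ℤ ≡ k + x
last≡ = solve-∀

coprime⇒gcd≡1ℤ : ∀ {a b} → Coprime a b → gcd a b ≡ 1ℤ
coprime⇒gcd≡1ℤ c = cong +_ (coprime⇒gcd≡1 c)

coprime-shift : ∀ {a c} → Coprime a c → Coprime a (a + c)
coprime-shift {a} {c} a⊥c {d} (d∣a , d∣a+c) =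
  a⊥c (d∣a , ∣⇒∣ᵤ {+ d} {c} (∣m+n∣m⇒∣n (∣ᵤ⇒∣ {+ d} {a + c} d∣a+c) (∣ᵤ⇒∣ {+ d} {a} d∣a)))

coprime-neg : ∀ {a c} → Coprime a c → Coprime a (- c)
coprime-neg {c = c} a⊥c (d∣a , d∣-c) = a⊥c (d∣a , subst (_ ℕD.∣_) (ℤP.∣-i∣≡∣i∣ c) d∣-c)

coprime-1 : ∀ {a} → Coprime a 1ℤ
coprime-1 (_ , d∣1) = ∣1⇒≡1 d∣1

coprime-prime : ∀ {a p} → Prime p → ¬ (p ℕD.∣ ∣ a ∣) → Coprime a (+ p)
coprime-prime prime-p p∤a (d∣a , d∣p) with prime⇒irreducible prime-p d∣p
... | inj₁ d≡1 = d≡1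
... | inj₂ refl = ⊥-elim (p∤a d∣a)

odd⇒nonZero : ∀ {c} → Odd c → c ≢ 0ℤ
odd⇒nonZero odd-c refl = odd-c (2 ℕD.∣0)

odd-1 : Odd 1ℤ
odd-1 2∣1 with ∣1⇒≡1 2∣1
... | ()

odd-neg : ∀ {c} → Odd c → Odd (- c)
odd-neg {c} odd-c 2∣-c = odd-c (subst (2 ℕD.∣_) (ℤP.∣-i∣≡∣i∣ c) 2∣-c)

odd-divisor : ∀ {d m} → Odd (+ m) → d ℕD.∣ m → Odd (+ d)
odd-divisor odd-m d∣m 2∣d = odd-m (∣-trans 2∣d d∣m)

odd-pred₂ : ∀ {r} → Odd (+ suc (suc r)) → Odd (+ r)
odd-pred₂ odd-r+2 2∣r = odd-r+2 (ℕD.∣m∣n⇒∣m+n ∣-refl 2∣r)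

primeDivisor : ∀ r → 2 ≤ r → Σ ℕ λ p → Prime p × p ℕD.∣ r
primeDivisor (suc zero) (s≤s ())
primeDivisor r@(suc (suc _)) _ with factorise r
... | record { factors = p ∷ ps ; isFactorisation = r≡Πfactors ; factorsPrime = prime-p ∷ _ } =
  p , prime-p , subst (p ℕD.∣_) (sym r≡Πfactors) (ℕD.m∣m*n (product ps))

oddPrimeDivisor : ∀ r → 2 ≤ r → Odd (+ r) →
  Σ ℕ λ p → Prime p × Odd (+ p) × p ≤ r × p ℕD.∣ r
oddPrimeDivisor (suc zero) (s≤s ())
oddPrimeDivisor r@(suc (suc _)) 2≤r odd-r with primeDivisor r 2≤r
... | p , prime-p , p∣r = p , prime-p , odd-divisor odd-r p∣r , ℕD.∣⇒≤ p∣r , p∣r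

prime∤consecutive : ∀ {p r} → Prime p → p ℕD.∣ r → ¬ (p ℕD.∣ suc r)
prime∤consecutive {p} {r} prime-p p∣r p∣1+r =
  ℕ.nonTrivial⇒≢1 {{prime⇒nonTrivial prime-p}} (∣1⇒≡1 p∣1)
  where
  p∣1 : p ℕD.∣ 1
  p∣1 = ℕD.∣m+n∣m⇒∣n (subst (p ℕD.∣_) (ℕP.+-comm 1 r) p∣1+r) p∣r

oppNbr-at-offset : ∀ {k n v c} → InCP k n v → InCP k n (v + c) →
  Odd c → Coprime v c → OppNbr k n v (v + c)
oppNbr-at-offset {v = v} {c} v∈ v+c∈ odd-c v⊥c =
  (v∈ , v+c∈ , v≢v+c , coprime⇒gcd≡1ℤ {v} {v + c} (coprime-shift {v} {c} v⊥c)) ,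
  subst Odd (sym v+c-v≡c) odd-c
  where
  v≢v+c : v ≢ v + c
  v≢v+c v≡v+c = odd⇒nonZero odd-c (sym (∙-cancelˡ v 0ℤ c (trans (ℤP.+-identityʳ v) v≡v+c)))
  v+c-v≡c : (v + c) - v ≡ c
  v+c-v≡c = +-sub-cancelˡ v c

twoOppNbrs-at-offsets : ∀ {k n v c₁ c₂} → InCP k n v →
  InCP k n (v + c₁) → InCP k n (v + c₂) → c₁ ≢ c₂ →
  Odd c₁ → Odd c₂ → Coprime v c₁ → Coprime v c₂ → TwoOppNbrs k n v
twoOppNbrs-at-offsets {k} {n} {v} {c₁} {c₂} v∈ v+c₁∈ v+c₂∈ c₁≢c₂ odd₁ odd₂ v⊥c₁ v⊥c₂ =
  v + c₁ , v + c₂ , (λ eq → c₁≢c₂ (∙-cancelˡ v c₁ c₂ eq)) ,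
  oppNbr-at-offset {k} {n} v∈ v+c₁∈ odd₁ v⊥c₁ , oppNbr-at-offset {k} {n} v∈ v+c₂∈ odd₂ v⊥c₂

first-twoOppNbrs : ∀ {k n p} → Prime p → Odd (+ p) → p < n →
  ¬ (p ℕD.∣ ∣ k ∣) → TwoOppNbrs k n k
first-twoOppNbrs {k} {n} {p} prime-p odd-p p<n p∤k =
  twoOppNbrs-at-offsets {k} {n} {k} {1ℤ} {+ p}
    (0 , 0<n , sym (ℤP.+-identityʳ k)) (1 , 1<n , refl) (p , p<n , refl)
    1≢p odd-1 odd-p (coprime-1 {k}) (coprime-prime {k} prime-p p∤k)
  where
  1<n : 1 < n
  1<n = ℕP.<-trans (ℕ.nonTrivial⇒n>1 p {{prime⇒nonTrivial prime-p}}) p<n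
  0<n : 0 < n
  0<n = ℕP.<-trans (s≤s z≤n) 1<n
  1≢p : 1ℤ ≢ + p
  1≢p refl = ¬prime[1] prime-p

inCP-below-last : ∀ {k n} i j → suc (i ℕ.+ j) ≡ n → InCP k n (((k + + n) - 1ℤ) - + j)
inCP-below-last {k} i j refl = i , s≤s (ℕP.m≤m+n i j) , last-minus k (+ i) (+ j)

-- The end vertices k and k + r + 1 of CP(k, r + 2) differ by r + 1, so a
-- prime divisor of r divides at most one of them.
prime∤both-ends : ∀ {k r p} → Prime p → p ℕD.∣ r → p ℕD.∣ ∣ k ∣ →
  ¬ (p ℕD.∣ ∣ (k + + suc (suc r)) - 1ℤ ∣)
prime∤both-ends {k} {r} {p} prime-p p∣r p∣k p∣m =
  prime∤consecutive prime-p p∣r (∣⇒∣ᵤ {+ p} {+ suc r} (subst (+ p ∣ₛ_) m-k≡1+r p∣m-k))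
  where
  m : ℤ
  m = (k + + suc (suc r)) - 1ℤ
  p∣m-k : + p ∣ₛ m - k
  p∣m-k = ∣m∣n⇒∣m-n {+ p} {m} {k} (∣ᵤ⇒∣ {+ p} {m} p∣m) (∣ᵤ⇒∣ {+ p} {k} p∣k)
  m-k≡1+r : m - k ≡ + suc r
  m-k≡1+r = last-minus-first k (+ suc r)

last-twoOppNbrs : ∀ {k r p} → Prime p → Odd (+ p) → p ≤ r →
  ¬ (p ℕD.∣ ∣ (k + + suc (suc r)) - 1ℤ ∣) →
  TwoOppNbrs k (suc (suc r)) ((k + + suc (suc r)) - 1ℤ)
last-twoOppNbrs {k} {r} {p} prime-p odd-p p≤r p∤m =
  twoOppNbrs-at-offsets {k} {suc (suc r)} {m} { -1ℤ} { - + p}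
    m∈ (inCP-below-last {k} r 1 (cong suc (ℕP.+-comm r 1)))
    (inCP-below-last {k} (suc r ∸ p) p (cong suc (ℕP.m∸n+n≡m (ℕP.m≤n⇒m≤1+n p≤r))))
    -1≢-p odd-1 (odd-neg {+ p} odd-p) (coprime-neg {m} {1ℤ} (coprime-1 {m}))
    (coprime-neg {m} {+ p} (coprime-prime {m} prime-p p∤m))
  where
  m : ℤ
  m = (k + + suc (suc r)) - 1ℤ
  m∈ : InCP k (suc (suc r)) m
  m∈ = suc r , ℕP.≤-refl , last≡ k (+ suc r)
  -1≢-p : -1ℤ ≢ - + p
  -1≢-p -1≡-p = ¬prime[1] (subst Prime (sym (cong ∣_∣ (ℤP.neg-injective -1≡-p))) prime-p)

lemma2p8 : (k : ℤ) (n : ℕ) → Odd k → Odd (+ n) → 5 ≤ n →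
    TwoOppNbrs k n k ⊎ TwoOppNbrs k n ((k + + n) - 1ℤ)
lemma2p8 k (suc (suc r)) _ odd-n (s≤s (s≤s 2<r))
  with oddPrimeDivisor r (ℕP.<⇒≤ 2<r) (odd-pred₂ odd-n)
... | p , prime-p , odd-p , p≤r , p∣r with p ℕD.∣? ∣ k ∣
...   | no p∤k = inj₁ (first-twoOppNbrs {k} prime-p odd-p (s≤s (ℕP.m≤n⇒m≤1+n p≤r)) p∤k)
...   | yes p∣k = inj₂ (last-twoOppNbrs {k} prime-p odd-p p≤r (prime∤both-ends {k} prime-p p∣r p∣k))
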